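{- Let $C$ be a circuit of an antisymmetric matroid on $E$ and let $e\in C$. If $C\setminus\{e\}$ contains no skew pair, then there is a basis $B$ that is a transversal with $C\setminus B=\{e\}$.
   Context: Let $E=[n]\cup[n]^*$ with involution $i\leftrightarrow i^*$; a skew pair is $\{i,i^*\}$; $\mathcal{T}_n$ (transversals) are $n$-subsets of $E$ with no skew pair, $\mathcal{A}_n$ (almost-transversals) $n$-subsets with exactly one skew pair. An antisymmetric matroid on $E$ is $(E,\mathcal{B})$ with $\mathcal{B}\subseteq\mathcal{T}_n\cup\mathcal{A}_n$ satisfying (B1) $\mathcal{B}\ne\emptyset$; (B2) for $T\in\mathcal{T}_n$ and distinct skew pairs $p,q$, $(T\cup p)\setminus q\in\mathcal{B}$ iff $(T\cup q)\setminus p\in\mathcal{B}$; (Exch) for $B,B'\in\mathcal{B}$ and $e\in B\setminus B'$ with $B\setminus\{e\}$ having no skew pair and $B'\cup\{e\}$ having exactly one skew pair, there is $f\in B'\setminus B$ with both $(B\setminus\{e\})\cup\{f\}$ and $(B'\cup\{e\})\setminus\{f\}$ in $\mathcal{B}$. Elements of $\mathcal{B}$ are bases. A circuit is an inclusion-minimal subset of $E$ containing at most one skew pair and contained in no basis. -}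

module Defs where

open import Data.Nat using (ℕ; _+_; _≤_)
open import Data.Bool using (Bool; true; false)
open import Data.Fin using (Fin)
open import Data.Fin.Subset as S using (Subset)
open import Data.Product using (_×_; _,_; proj₁; proj₂; Σ; ∃)
open import Data.Sum using (_⊎_)
open import Data.Empty using (⊥)
open import Relation.Nullary using (¬_)
open import Relation.Binary.PropositionalEquality using (_≡_)
open import Function.Bundles using (_⇔_)

-- The ground set E = [n] ∪ [n]* is encoded as Fin n × Bool:
-- (i , false) is the element i, (i , true) is the element i*.
Elem : ℕ → Set
Elem n = Fin n × Bool

star : ∀ {n} → Elem n → Elem n
star (i , b) = (i , Data.Bool.not b)

-- A subset of E: the unstarred part and the starred part.
ESet : ℕ → Set
ESet n = Subset n × Subset n

module _ {n : ℕ} where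

  _∈ₑ_ : Elem n → ESet n → Set
  (i , false) ∈ₑ X = i S.∈ proj₁ X
  (i , true)  ∈ₑ X = i S.∈ proj₂ X

  _∉ₑ_ : Elem n → ESet n → Set
  x ∉ₑ X = ¬ (x ∈ₑ X)

  _⊆ₑ_ : ESet n → ESet n → Set
  X ⊆ₑ Y = ∀ x → x ∈ₑ X → x ∈ₑ Y

  _⊂ₑ_ : ESet n → ESet n → Set
  X ⊂ₑ Y = X ⊆ₑ Y × ∃ λ y → y ∈ₑ Y × y ∉ₑ X

  _≐_ : ESet n → ESet n → Set
  X ≐ Y = X ⊆ₑ Y × Y ⊆ₑ X

  _∪ₑ_ : ESet n → ESet n → ESet n
  (a , b) ∪ₑ (c , d) = (a S.∪ c , b S.∪ d)

  _∖ₑ_ : ESet n → ESet n → ESet n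
  (a , b) ∖ₑ (c , d) = (a S.─ c , b S.─ d)

  ∅ₑ : ESet n
  ∅ₑ = (S.⊥ , S.⊥)

  ⁅_⁆ₑ : Elem n → ESet n
  ⁅ (i , false) ⁆ₑ = (S.⁅ i ⁆ , S.⊥)
  ⁅ (i , true)  ⁆ₑ = (S.⊥ , S.⁅ i ⁆)

  skew : Fin n → ESet n
  skew i = (S.⁅ i ⁆ , S.⁅ i ⁆)

  size : ESet n → ℕ
  size (a , b) = S.∣ a ∣ + S.∣ b ∣

  #skew : ESet n → ℕ
  #skew (a , b) = S.∣ a S.∩ b ∣

  IsTransversal : ESet n → Set
  IsTransversal X = size X ≡ n × #skew X ≡ 0

  IsAlmostTransversal : ESet n → Set
  IsAlmostTransversal X = size X ≡ n × #skew X ≡ 1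

record AntisymmetricMatroid (n : ℕ) : Set₁ where
  field
    IsBasis : ESet n → Set
    basis-type : ∀ B → IsBasis B → IsTransversal B ⊎ IsAlmostTransversal B
    B1 : ∃ IsBasis
    B2 : ∀ T (p q : Fin n) → IsTransversal T → ¬ (p ≡ q) →
         IsBasis ((T ∪ₑ skew p) ∖ₑ skew q) ⇔ IsBasis ((T ∪ₑ skew q) ∖ₑ skew p)
    Exch : ∀ B B' e → IsBasis B → IsBasis B' → e ∈ₑ B → e ∉ₑ B' →
           #skew (B ∖ₑ ⁅ e ⁆ₑ) ≡ 0 → #skew (B' ∪ₑ ⁅ e ⁆ₑ) ≡ 1 →
           ∃ λ f → f ∈ₑ B' × f ∉ₑ B ×
             IsBasis ((B ∖ₑ ⁅ e ⁆ₑ) ∪ₑ ⁅ f ⁆ₑ) ×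
             IsBasis ((B' ∪ₑ ⁅ e ⁆ₑ) ∖ₑ ⁅ f ⁆ₑ)

  Independent : ESet n → Set
  Independent X = ∃ λ B → IsBasis B × X ⊆ₑ B

  IsCircuit : ESet n → Set
  IsCircuit C = (#skew C ≤ 1 × ¬ Independent C) ×
                (∀ D → D ⊂ₑ C → #skew D ≤ 1 → Independent D)

-- C ∖ {e} is a proper subset of the circuit C with no skew pair, so it lies in a basis B, and
-- e ∉ B because C itself is dependent; hence it suffices to find such a B that is a transversal.
-- If B is an almost-transversal, it has the shape (T ∪ {i,i*}) ∖ {j,j*} for a transversal T, and
-- by (B2) B' = (T ∪ {j,j*}) ∖ {i,i*} is a basis as well. Since C ∖ {e} has no skew pair, it misses
-- some a ∈ {i,i*}. Exchanging a out of B against B' must bring in an element of {j,j*}, the only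
-- part of B' outside B; the resulting basis has no skew pair, so it is a transversal, and it
-- still contains C ∖ {e}.
module Submission where

open import Defs
open import Data.Nat using (ℕ; suc; _+_; _≤_; z≤n)
open import Data.Nat.Properties using (+-suc; suc-injective; +-cancelˡ-≡; +-identityʳ)
open import Data.Bool as Bool using (Bool; true; false; not; _∧_; _∨_)
open import Data.Bool.Properties
  using (∧-zeroʳ; ∧-identityʳ; ∨-zeroʳ; ∨-identityʳ; ∧-conicalˡ; ∧-conicalʳ; not-¬; ¬-not; not-injective)
open import Data.Fin using (Fin; zero; suc; _≟_)
open import Data.Fin.Subset using (Subset; inside; outside; ⊥; ⁅_⁆; ∁; _∩_; _─_; ∣_∣)
open import Data.Fin.Subset.Properties using (∣⊥∣≡0; ∣⁅x⁆∣≡1)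
open import Data.Vec using ([]; _∷_; lookup; tabulate)
open import Data.Vec.Properties
  using (lookup-replicate; lookup-zipWith; lookup-map; tabulate∘lookup; tabulate-cong; []=⇒lookup; lookup⇒[]=)
open import Data.Product using (_×_; ∃; ∃₂; _,_; proj₁; proj₂)
open import Data.Product.Properties using (≡-dec; ,-injectiveˡ; ,-injectiveʳ)
open import Data.Sum using (inj₁; inj₂)
open import Function using (_∘_; flip)
open import Function.Bundles using (Equivalence)
open import Relation.Nullary using (¬_; does; yes; no; contradiction)
open import Relation.Nullary.Decidable using (dec-true; dec-false)
open import Relation.Binary.Definitions using (DecidableEquality)
open import Relation.Binary.PropositionalEquality

private variable n : ℕ

-- Subsets of Fin n

lookup-─ : ∀ (p q : Subset n) k → lookup (p ─ q) k ≡ lookup p k ∧ not (lookup q k)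
lookup-─ (x ∷ _) (inside  ∷ _) zero    = sym (∧-zeroʳ x)
lookup-─ (x ∷ _) (outside ∷ _) zero    = sym (∧-identityʳ x)
lookup-─ (_ ∷ p) (_       ∷ q) (suc k) = lookup-─ p q k

lookup-⁅⁆ : ∀ (i k : Fin n) → lookup ⁅ i ⁆ k ≡ does (k ≟ i)
lookup-⁅⁆ zero    zero    = refl
lookup-⁅⁆ zero    (suc k) = lookup-replicate k outside
lookup-⁅⁆ (suc i) zero    = refl
lookup-⁅⁆ (suc i) (suc k) = lookup-⁅⁆ i k

lookup-injective : ∀ (p q : Subset n) → lookup p ≗ lookup q → p ≡ q
lookup-injective p q p≗q = begin
  p                   ≡⟨ tabulate∘lookup p ⟨
  tabulate (lookup p) ≡⟨ tabulate-cong p≗q ⟩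
  tabulate (lookup q) ≡⟨ tabulate∘lookup q ⟩
  q                   ∎
  where open ≡-Reasoning

∣p∣≡0⇒p≡⊥ : ∀ (p : Subset n) → ∣ p ∣ ≡ 0 → p ≡ ⊥
∣p∣≡0⇒p≡⊥ []            _     = refl
∣p∣≡0⇒p≡⊥ (outside ∷ p) ∣p∣≡0 = cong (outside ∷_) (∣p∣≡0⇒p≡⊥ p ∣p∣≡0)

∣p∣≡1⇒p≡⁅x⁆ : ∀ (p : Subset n) → ∣ p ∣ ≡ 1 → ∃ λ x → p ≡ ⁅ x ⁆
∣p∣≡1⇒p≡⁅x⁆ (inside  ∷ p) ∣p∣≡1 = zero , cong (inside ∷_) (∣p∣≡0⇒p≡⊥ p (suc-injective ∣p∣≡1))
∣p∣≡1⇒p≡⁅x⁆ (outside ∷ p) ∣p∣≡1 with x , p≡⁅x⁆ ← ∣p∣≡1⇒p≡⁅x⁆ p ∣p∣≡1 = suc x , cong (outside ∷_) p≡⁅x⁆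

∣p∣≡0⇒lookup≡false : ∀ (p : Subset n) → ∣ p ∣ ≡ 0 → ∀ k → lookup p k ≡ false
∣p∣≡0⇒lookup≡false p ∣p∣≡0 k = begin
  lookup p k ≡⟨ cong (flip lookup k) (∣p∣≡0⇒p≡⊥ p ∣p∣≡0) ⟩
  lookup ⊥ k ≡⟨ lookup-replicate k outside ⟩
  false      ∎
  where open ≡-Reasoning

lookup≡false⇒∣p∣≡0 : ∀ (p : Subset n) → (∀ k → lookup p k ≡ false) → ∣ p ∣ ≡ 0
lookup≡false⇒∣p∣≡0 {n} p p≗⊥ = begin
  ∣ p ∣     ≡⟨ cong ∣_∣ (lookup-injective p ⊥ λ k → trans (p≗⊥ k) (sym (lookup-replicate k outside))) ⟩
  ∣ ⊥ {n} ∣ ≡⟨ ∣⊥∣≡0 n ⟩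
  0         ∎
  where open ≡-Reasoning

∣p∣≡1⇒lookup≡[k≟x] : ∀ (p : Subset n) → ∣ p ∣ ≡ 1 → ∃ λ x → ∀ k → lookup p k ≡ does (k ≟ x)
∣p∣≡1⇒lookup≡[k≟x] p ∣p∣≡1 with x , p≡⁅x⁆ ← ∣p∣≡1⇒p≡⁅x⁆ p ∣p∣≡1 =
  x , λ k → trans (cong (flip lookup k) p≡⁅x⁆) (lookup-⁅⁆ x k)

lookup≡[k≟x]⇒∣p∣≡1 : ∀ (p : Subset n) x → (∀ k → lookup p k ≡ does (k ≟ x)) → ∣ p ∣ ≡ 1
lookup≡[k≟x]⇒∣p∣≡1 p x p≗⁅x⁆ = begin
  ∣ p ∣     ≡⟨ cong ∣_∣ (lookup-injective p ⁅ x ⁆ λ k → trans (p≗⁅x⁆ k) (sym (lookup-⁅⁆ x k))) ⟩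
  ∣ ⁅ x ⁆ ∣ ≡⟨ ∣⁅x⁆∣≡1 x ⟩
  1         ∎
  where open ≡-Reasoning

∣p∣+∣q∣+∣∁p∩∁q∣≡n+∣p∩q∣ : ∀ (p q : Subset n) → ∣ p ∣ + ∣ q ∣ + ∣ ∁ p ∩ ∁ q ∣ ≡ n + ∣ p ∩ q ∣
∣p∣+∣q∣+∣∁p∩∁q∣≡n+∣p∩q∣ []            []            = refl
∣p∣+∣q∣+∣∁p∩∁q∣≡n+∣p∩q∣ {suc n} (inside  ∷ p) (inside  ∷ q) = cong suc (begin
  ∣ p ∣ + suc ∣ q ∣ + ∣ ∁ p ∩ ∁ q ∣   ≡⟨ cong (_+ ∣ ∁ p ∩ ∁ q ∣) (+-suc ∣ p ∣ ∣ q ∣) ⟩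
  suc (∣ p ∣ + ∣ q ∣ + ∣ ∁ p ∩ ∁ q ∣) ≡⟨ cong suc (∣p∣+∣q∣+∣∁p∩∁q∣≡n+∣p∩q∣ p q) ⟩
  suc (n + ∣ p ∩ q ∣)                 ≡⟨ +-suc n ∣ p ∩ q ∣ ⟨
  n + suc ∣ p ∩ q ∣                   ∎)
  where open ≡-Reasoning
∣p∣+∣q∣+∣∁p∩∁q∣≡n+∣p∩q∣ (inside  ∷ p) (outside ∷ q) = cong suc (∣p∣+∣q∣+∣∁p∩∁q∣≡n+∣p∩q∣ p q)
∣p∣+∣q∣+∣∁p∩∁q∣≡n+∣p∩q∣ (outside ∷ p) (inside  ∷ q) =
  trans (cong (_+ ∣ ∁ p ∩ ∁ q ∣) (+-suc ∣ p ∣ ∣ q ∣)) (cong suc (∣p∣+∣q∣+∣∁p∩∁q∣≡n+∣p∩q∣ p q))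
∣p∣+∣q∣+∣∁p∩∁q∣≡n+∣p∩q∣ (outside ∷ p) (outside ∷ q) =
  trans (+-suc (∣ p ∣ + ∣ q ∣) ∣ ∁ p ∩ ∁ q ∣) (cong suc (∣p∣+∣q∣+∣∁p∩∁q∣≡n+∣p∩q∣ p q))

-- Characteristic functions of subsets of E

χ : ESet n → Elem n → Bool
χ (p , q) (k , false) = lookup p k
χ (p , q) (k , true)  = lookup q k

∈ₑ⇒χ : ∀ {X : ESet n} x → x ∈ₑ X → χ X x ≡ true
∈ₑ⇒χ (k , false) = []=⇒lookup
∈ₑ⇒χ (k , true)  = []=⇒lookup

χ⇒∈ₑ : ∀ {X : ESet n} x → χ X x ≡ true → x ∈ₑ X
χ⇒∈ₑ (k , false) = lookup⇒[]= k _
χ⇒∈ₑ (k , true)  = lookup⇒[]= k _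

∉ₑ⇒χ : ∀ {X : ESet n} x → x ∉ₑ X → χ X x ≡ false
∉ₑ⇒χ x x∉X = ¬-not (x∉X ∘ χ⇒∈ₑ x)

χ⇒∉ₑ : ∀ {X : ESet n} x → χ X x ≡ false → x ∉ₑ X
χ⇒∉ₑ x χ≡false x∈X = contradiction (trans (sym (∈ₑ⇒χ x x∈X)) χ≡false) λ ()

χ-injective : ∀ (X Y : ESet n) → χ X ≗ χ Y → X ≡ Y
χ-injective X Y X≗Y = cong₂ _,_ (lookup-injective (proj₁ X) (proj₁ Y) (X≗Y ∘ (_, false)))
                                (lookup-injective (proj₂ X) (proj₂ Y) (X≗Y ∘ (_, true)))

χ-∪ : ∀ (X Y : ESet n) x → χ (X ∪ₑ Y) x ≡ χ X x ∨ χ Y x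
χ-∪ X Y (k , false) = lookup-zipWith _∨_ k (proj₁ X) (proj₁ Y)
χ-∪ X Y (k , true)  = lookup-zipWith _∨_ k (proj₂ X) (proj₂ Y)

χ-∖ : ∀ (X Y : ESet n) x → χ (X ∖ₑ Y) x ≡ χ X x ∧ not (χ Y x)
χ-∖ X Y (k , false) = lookup-─ (proj₁ X) (proj₁ Y) k
χ-∖ X Y (k , true)  = lookup-─ (proj₂ X) (proj₂ Y) k

χ-skew : ∀ (i k : Fin n) b → χ (skew i) (k , b) ≡ does (k ≟ i)
χ-skew i k false = lookup-⁅⁆ i k
χ-skew i k true  = lookup-⁅⁆ i k

χ-⁅x⁆-x : ∀ (x : Elem n) → χ ⁅ x ⁆ₑ x ≡ true
χ-⁅x⁆-x (k , false) = trans (lookup-⁅⁆ k k) (dec-true (k ≟ k) refl)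
χ-⁅x⁆-x (k , true)  = trans (lookup-⁅⁆ k k) (dec-true (k ≟ k) refl)

χ-⁅y⁆-x : ∀ {x y : Elem n} → x ≢ y → χ ⁅ y ⁆ₑ x ≡ false
χ-⁅y⁆-x {x = k , false} {j , false} x≢y = trans (lookup-⁅⁆ j k) (dec-false (k ≟ j) (x≢y ∘ cong (_, false)))
χ-⁅y⁆-x {x = k , false} {j , true}  _   = lookup-replicate k false
χ-⁅y⁆-x {x = k , true}  {j , false} _   = lookup-replicate k false
χ-⁅y⁆-x {x = k , true}  {j , true}  x≢y = trans (lookup-⁅⁆ j k) (dec-false (k ≟ j) (x≢y ∘ cong (_, true)))

χ-∖⁅x⁆-x : ∀ (X : ESet n) x → χ (X ∖ₑ ⁅ x ⁆ₑ) x ≡ false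
χ-∖⁅x⁆-x X x rewrite χ-∖ X ⁅ x ⁆ₑ x | χ-⁅x⁆-x x = ∧-zeroʳ (χ X x)

χ-∖⁅y⁆-x : ∀ (X : ESet n) x y → x ≢ y → χ (X ∖ₑ ⁅ y ⁆ₑ) x ≡ χ X x
χ-∖⁅y⁆-x X x y x≢y rewrite χ-∖ X ⁅ y ⁆ₑ x | χ-⁅y⁆-x x≢y = ∧-identityʳ (χ X x)

χ-∪⁅x⁆-x : ∀ (X : ESet n) x → χ (X ∪ₑ ⁅ x ⁆ₑ) x ≡ true
χ-∪⁅x⁆-x X x rewrite χ-∪ X ⁅ x ⁆ₑ x | χ-⁅x⁆-x x = ∨-zeroʳ (χ X x)

χ-∪⁅y⁆-x : ∀ (X : ESet n) x y → x ≢ y → χ (X ∪ₑ ⁅ y ⁆ₑ) x ≡ χ X x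
χ-∪⁅y⁆-x X x y x≢y rewrite χ-∪ X ⁅ y ⁆ₑ x | χ-⁅y⁆-x x≢y = ∨-identityʳ (χ X x)

module _ (X : ESet n) (i j : Fin n) where

  χ-∪skew∖skew-i : i ≢ j → ∀ b → χ ((X ∪ₑ skew i) ∖ₑ skew j) (i , b) ≡ true
  χ-∪skew∖skew-i i≢j b
    rewrite χ-∖ (X ∪ₑ skew i) (skew j) (i , b) | χ-∪ X (skew i) (i , b) | χ-skew i i b | χ-skew j i b
          | dec-true (i ≟ i) refl | dec-false (i ≟ j) i≢j | ∨-zeroʳ (χ X (i , b)) = refl

  χ-∪skew∖skew-j : ∀ b → χ ((X ∪ₑ skew i) ∖ₑ skew j) (j , b) ≡ false
  χ-∪skew∖skew-j b
    rewrite χ-∖ (X ∪ₑ skew i) (skew j) (j , b) | χ-skew j j b | dec-true (j ≟ j) refl = ∧-zeroʳ _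

  χ-∪skew∖skew-k : ∀ {k} → k ≢ i → k ≢ j → ∀ b → χ ((X ∪ₑ skew i) ∖ₑ skew j) (k , b) ≡ χ X (k , b)
  χ-∪skew∖skew-k {k} k≢i k≢j b
    rewrite χ-∖ (X ∪ₑ skew i) (skew j) (k , b) | χ-∪ X (skew i) (k , b) | χ-skew i k b | χ-skew j k b
          | dec-false (k ≟ i) k≢i | dec-false (k ≟ j) k≢j | ∨-identityʳ (χ X (k , b)) = ∧-identityʳ _

_≟ₑ_ : DecidableEquality (Elem n)
_≟ₑ_ = ≡-dec _≟_ Bool._≟_

star≢ : ∀ (x : Elem n) → star x ≢ x
star≢ (k , b) = not-¬ refl ∘ sym ∘ ,-injectiveʳ

≡⇒≐ : ∀ {X Y : ESet n} → X ≡ Y → X ≐ Y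
≡⇒≐ refl = (λ _ x∈X → x∈X) , (λ _ x∈X → x∈X)

∖-⊆ : ∀ (X Y : ESet n) → (X ∖ₑ Y) ⊆ₑ X
∖-⊆ X Y x x∈X∖Y = χ⇒∈ₑ x (∧-conicalˡ _ _ (trans (sym (χ-∖ X Y x)) (∈ₑ⇒χ x x∈X∖Y)))

∖⁅x⁆⊂ : ∀ {X : ESet n} {x} → x ∈ₑ X → (X ∖ₑ ⁅ x ⁆ₑ) ⊂ₑ X
∖⁅x⁆⊂ {X = X} {x} x∈X = ∖-⊆ X ⁅ x ⁆ₑ , x , x∈X , χ⇒∉ₑ x (χ-∖⁅x⁆-x X x)

⊆-∪ : ∀ {X Y : ESet n} Z → X ⊆ₑ Y → X ⊆ₑ (Y ∪ₑ Z)
⊆-∪ {Y = Y} Z X⊆Y x x∈X = χ⇒∈ₑ x (trans (χ-∪ Y Z x) (cong (_∨ χ Z x) (∈ₑ⇒χ x (X⊆Y x x∈X))))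

⊆-∖⁅x⁆ : ∀ {X Y : ESet n} {x} → X ⊆ₑ Y → x ∉ₑ X → X ⊆ₑ (Y ∖ₑ ⁅ x ⁆ₑ)
⊆-∖⁅x⁆ {Y = Y} {x} X⊆Y x∉X y y∈X =
  χ⇒∈ₑ y (trans (χ-∖⁅y⁆-x Y y x λ { refl → x∉X y∈X }) (∈ₑ⇒χ y (X⊆Y y y∈X)))

-- Skew pairs

hasPair : ESet n → Fin n → Bool
hasPair X k = χ X (k , false) ∧ χ X (k , true)

missesPair : ESet n → Fin n → Bool
missesPair X k = not (χ X (k , false)) ∧ not (χ X (k , true))

hasPair-absent : ∀ (X : ESet n) {k} b → χ X (k , b) ≡ false → hasPair X k ≡ false
hasPair-absent X false absent rewrite absent = refl
hasPair-absent X true  absent rewrite absent = ∧-zeroʳ _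

hasPair-full : ∀ (X : ESet n) {k} → (∀ b → χ X (k , b) ≡ true) → hasPair X k ≡ true
hasPair-full X full = cong₂ _∧_ (full false) (full true)

hasPair⇒χ : ∀ (X : ESet n) {k} → hasPair X k ≡ true → ∀ b → χ X (k , b) ≡ true
hasPair⇒χ X pair false = ∧-conicalˡ _ _ pair
hasPair⇒χ X pair true  = ∧-conicalʳ _ _ pair

missesPair⇒χ : ∀ (X : ESet n) {k} → missesPair X k ≡ true → ∀ b → χ X (k , b) ≡ false
missesPair⇒χ X none false = not-injective (∧-conicalˡ _ _ none)
missesPair⇒χ X none true  = not-injective (∧-conicalʳ _ _ none)

noPair⇒absent : ∀ (X : ESet n) {k} → hasPair X k ≡ false → ∃ λ b → χ X (k , b) ≡ false
noPair⇒absent X {k} noPair with χ X (k , false) in χ≡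
... | false = false , χ≡
... | true  = true , noPair

hasPair-cong : ∀ (X Y : ESet n) {k} → (∀ b → χ X (k , b) ≡ χ Y (k , b)) → hasPair X k ≡ hasPair Y k
hasPair-cong X Y eq = cong₂ _∧_ (eq false) (eq true)

missesPair-cong : ∀ (X Y : ESet n) {k} → (∀ b → χ X (k , b) ≡ χ Y (k , b)) → missesPair X k ≡ missesPair Y k
missesPair-cong X Y eq = cong₂ (λ u v → not u ∧ not v) (eq false) (eq true)

pairs : ESet n → Subset n
pairs (p , q) = p ∩ q

missing : ESet n → Subset n
missing (p , q) = ∁ p ∩ ∁ q

lookup-pairs : ∀ (X : ESet n) k → lookup (pairs X) k ≡ hasPair X k
lookup-pairs X k = lookup-zipWith _∧_ k (proj₁ X) (proj₂ X)

lookup-missing : ∀ (X : ESet n) k → lookup (missing X) k ≡ missesPair X k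
lookup-missing X k = trans (lookup-zipWith _∧_ k (∁ (proj₁ X)) (∁ (proj₂ X)))
                           (cong₂ _∧_ (lookup-map k not (proj₁ X)) (lookup-map k not (proj₂ X)))

size+∣missing∣≡n+#skew : ∀ (X : ESet n) → size X + ∣ missing X ∣ ≡ n + #skew X
size+∣missing∣≡n+#skew (p , q) = ∣p∣+∣q∣+∣∁p∩∁q∣≡n+∣p∩q∣ p q

#skew≡0⇒noPair : ∀ (X : ESet n) → #skew X ≡ 0 → ∀ k → hasPair X k ≡ false
#skew≡0⇒noPair X #skew≡0 k = trans (sym (lookup-pairs X k)) (∣p∣≡0⇒lookup≡false (pairs X) #skew≡0 k)

noPair⇒#skew≡0 : ∀ (X : ESet n) → (∀ k → hasPair X k ≡ false) → #skew X ≡ 0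
noPair⇒#skew≡0 X noPair = lookup≡false⇒∣p∣≡0 (pairs X) λ k → trans (lookup-pairs X k) (noPair k)

#skew≡1⇒uniquePair : ∀ (X : ESet n) → #skew X ≡ 1 → ∃ λ i → ∀ k → hasPair X k ≡ does (k ≟ i)
#skew≡1⇒uniquePair X #skew≡1 with i , pairs≗⁅i⁆ ← ∣p∣≡1⇒lookup≡[k≟x] (pairs X) #skew≡1 =
  i , λ k → trans (sym (lookup-pairs X k)) (pairs≗⁅i⁆ k)

uniquePair⇒#skew≡1 : ∀ (X : ESet n) i → (∀ k → hasPair X k ≡ does (k ≟ i)) → #skew X ≡ 1
uniquePair⇒#skew≡1 X i uniquePair =
  lookup≡[k≟x]⇒∣p∣≡1 (pairs X) i λ k → trans (lookup-pairs X k) (uniquePair k)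

almostTransversal⇒uniqueMissingPair : ∀ (X : ESet n) → IsAlmostTransversal X →
  ∃ λ j → ∀ k → missesPair X k ≡ does (k ≟ j)
almostTransversal⇒uniqueMissingPair {n} X (size≡n , #skew≡1) =
  let j , missing≗⁅j⁆ = ∣p∣≡1⇒lookup≡[k≟x] (missing X) ∣missing∣≡1
  in  j , λ k → trans (sym (lookup-missing X k)) (missing≗⁅j⁆ k)
  where
  open ≡-Reasoning
  ∣missing∣≡1 : ∣ missing X ∣ ≡ 1
  ∣missing∣≡1 = +-cancelˡ-≡ n _ _ (begin
    n + ∣ missing X ∣      ≡⟨ cong (_+ ∣ missing X ∣) size≡n ⟨
    size X + ∣ missing X ∣ ≡⟨ size+∣missing∣≡n+#skew X ⟩
    n + #skew X            ≡⟨ cong (n +_) #skew≡1 ⟩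
    n + 1                  ∎)

noPair∧noMissingPair⇒transversal : ∀ (X : ESet n) → (∀ k → hasPair X k ≡ false) →
  (∀ k → missesPair X k ≡ false) → IsTransversal X
noPair∧noMissingPair⇒transversal {n} X noPair noMissing = size≡n , #skew≡0
  where
  open ≡-Reasoning
  #skew≡0 : #skew X ≡ 0
  #skew≡0 = noPair⇒#skew≡0 X noPair
  ∣missing∣≡0 : ∣ missing X ∣ ≡ 0
  ∣missing∣≡0 = lookup≡false⇒∣p∣≡0 (missing X) λ k → trans (lookup-missing X k) (noMissing k)
  size≡n : size X ≡ n
  size≡n = begin
    size X                 ≡⟨ +-identityʳ (size X) ⟨
    size X + 0             ≡⟨ cong (size X +_) ∣missing∣≡0 ⟨
    size X + ∣ missing X ∣ ≡⟨ size+∣missing∣≡n+#skew X ⟩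
    n + #skew X            ≡⟨ cong (n +_) #skew≡0 ⟩
    n + 0                  ≡⟨ +-identityʳ n ⟩
    n                      ∎

module ∪skew∖skew-Decomposition (X : ESet n) {i j : Fin n}
  (pairAt : ∀ k → hasPair X k ≡ does (k ≟ i)) (missAt : ∀ k → missesPair X k ≡ does (k ≟ j)) where

  open ≡-Reasoning

  X-i : ∀ b → χ X (i , b) ≡ true
  X-i = hasPair⇒χ X (trans (pairAt i) (dec-true (i ≟ i) refl))

  X-j : ∀ b → χ X (j , b) ≡ false
  X-j = missesPair⇒χ X (trans (missAt j) (dec-true (j ≟ j) refl))

  i≢j : i ≢ j
  i≢j refl = contradiction (trans (sym (X-i false)) (X-j false)) λ ()

  X⁻ T : ESet n
  X⁻ = X ∖ₑ ⁅ (i , true) ⁆ₑ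
  T  = X⁻ ∪ₑ ⁅ (j , false) ⁆ₑ

  T-i : ∀ b → χ T (i , b) ≡ not b
  T-i false = begin
    χ T (i , false)  ≡⟨ χ-∪⁅y⁆-x X⁻ (i , false) (j , false) (i≢j ∘ ,-injectiveˡ) ⟩
    χ X⁻ (i , false) ≡⟨ χ-∖⁅y⁆-x X (i , false) (i , true) (λ ()) ⟩
    χ X (i , false)  ≡⟨ X-i false ⟩
    true             ∎
  T-i true = begin
    χ T (i , true)   ≡⟨ χ-∪⁅y⁆-x X⁻ (i , true) (j , false) (i≢j ∘ ,-injectiveˡ) ⟩
    χ X⁻ (i , true)  ≡⟨ χ-∖⁅x⁆-x X (i , true) ⟩
    false            ∎

  T-j : ∀ b → χ T (j , b) ≡ not b
  T-j false = χ-∪⁅x⁆-x X⁻ (j , false)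
  T-j true = begin
    χ T (j , true)   ≡⟨ χ-∪⁅y⁆-x X⁻ (j , true) (j , false) (λ ()) ⟩
    χ X⁻ (j , true)  ≡⟨ χ-∖⁅y⁆-x X (j , true) (i , true) (i≢j ∘ sym ∘ ,-injectiveˡ) ⟩
    χ X (j , true)   ≡⟨ X-j true ⟩
    false            ∎

  T-k : ∀ {k} → k ≢ i → k ≢ j → ∀ b → χ T (k , b) ≡ χ X (k , b)
  T-k {k} k≢i k≢j b = begin
    χ T (k , b)      ≡⟨ χ-∪⁅y⁆-x X⁻ (k , b) (j , false) (k≢j ∘ ,-injectiveˡ) ⟩
    χ X⁻ (k , b)     ≡⟨ χ-∖⁅y⁆-x X (k , b) (i , true) (k≢i ∘ ,-injectiveˡ) ⟩
    χ X (k , b)      ∎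

  T-noPair : ∀ k → hasPair T k ≡ false
  T-noPair k with k ≟ i | k ≟ j
  ... | yes refl | _        = cong₂ _∧_ (T-i false) (T-i true)
  ... | no _     | yes refl = cong₂ _∧_ (T-j false) (T-j true)
  ... | no k≢i   | no k≢j   = trans (hasPair-cong T X (T-k k≢i k≢j)) (trans (pairAt k) (dec-false (k ≟ i) k≢i))

  T-noMissingPair : ∀ k → missesPair T k ≡ false
  T-noMissingPair k with k ≟ i | k ≟ j
  ... | yes refl | _        = cong₂ (λ u v → not u ∧ not v) (T-i false) (T-i true)
  ... | no _     | yes refl = cong₂ (λ u v → not u ∧ not v) (T-j false) (T-j true)
  ... | no k≢i   | no k≢j   = trans (missesPair-cong T X (T-k k≢i k≢j)) (trans (missAt k) (dec-false (k ≟ j) k≢j))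

  X≡T∪skew∖skew : X ≡ (T ∪ₑ skew i) ∖ₑ skew j
  X≡T∪skew∖skew = χ-injective X ((T ∪ₑ skew i) ∖ₑ skew j) X≗
    where
    X≗ : ∀ x → χ X x ≡ χ ((T ∪ₑ skew i) ∖ₑ skew j) x
    X≗ (k , b) with k ≟ i | k ≟ j
    ... | yes refl | _        = trans (X-i b) (sym (χ-∪skew∖skew-i T i j i≢j b))
    ... | no _     | yes refl = trans (X-j b) (sym (χ-∪skew∖skew-j T i j b))
    ... | no k≢i   | no k≢j   = sym (trans (χ-∪skew∖skew-k T i j k≢i k≢j b) (T-k k≢i k≢j b))

almostTransversal-decomposition : ∀ (X : ESet n) → IsAlmostTransversal X →
  ∃₂ λ i j → ∃ λ T → IsTransversal T × i ≢ j × X ≡ (T ∪ₑ skew i) ∖ₑ skew j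
almostTransversal-decomposition X almost =
  let i , pairAt = #skew≡1⇒uniquePair X (proj₂ almost)
      j , missAt = almostTransversal⇒uniqueMissingPair X almost
      open ∪skew∖skew-Decomposition X pairAt missAt
  in  i , j , T , noPair∧noMissingPair⇒transversal T T-noPair T-noMissingPair , i≢j , X≡T∪skew∖skew

-- Transversal bases

module _ {n} (M : AntisymmetricMatroid n) where

  open AntisymmetricMatroid M

  basis∧#skew≡0⇒transversal : ∀ {B} → IsBasis B → #skew B ≡ 0 → IsTransversal B
  basis∧#skew≡0⇒transversal {B} isB #skew≡0 with basis-type B isB
  ... | inj₁ transversal   = transversal
  ... | inj₂ (_ , #skew≡1) = contradiction (trans (sym #skew≡0) #skew≡1) λ ()

  module _ (T : ESet n) (T-transversal : IsTransversal T) {i j : Fin n} (i≢j : i ≢ j) (s : Bool) where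

    private
      B B' : ESet n
      B  = (T ∪ₑ skew i) ∖ₑ skew j
      B' = (T ∪ₑ skew j) ∖ₑ skew i

      a : Elem n
      a = (i , s)

      j≢i : j ≢ i
      j≢i = i≢j ∘ sym

      T-noPair : ∀ k → hasPair T k ≡ false
      T-noPair = #skew≡0⇒noPair T (proj₂ T-transversal)

      a∈B : a ∈ₑ B
      a∈B = χ⇒∈ₑ a (χ-∪skew∖skew-i T i j i≢j s)

      a∉B' : a ∉ₑ B'
      a∉B' = χ⇒∉ₑ a (χ-∪skew∖skew-j T j i s)

      B-noPair : ∀ {k} → k ≢ i → hasPair B k ≡ false
      B-noPair {k} k≢i with k ≟ j
      ... | yes refl = hasPair-absent B false (χ-∪skew∖skew-j T i j false)
      ... | no k≢j   = trans (hasPair-cong B T (χ-∪skew∖skew-k T i j k≢i k≢j)) (T-noPair k)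

      B∖a-noPair : ∀ k → hasPair (B ∖ₑ ⁅ a ⁆ₑ) k ≡ false
      B∖a-noPair k with k ≟ i
      ... | yes refl = hasPair-absent (B ∖ₑ ⁅ a ⁆ₑ) s (χ-∖⁅x⁆-x B a)
      ... | no k≢i   = trans (hasPair-cong (B ∖ₑ ⁅ a ⁆ₑ) B λ b → χ-∖⁅y⁆-x B (k , b) a (k≢i ∘ ,-injectiveˡ))
                             (B-noPair k≢i)

      B'∪a-uniquePair : ∀ k → hasPair (B' ∪ₑ ⁅ a ⁆ₑ) k ≡ does (k ≟ j)
      B'∪a-uniquePair k with k ≟ i | k ≟ j
      ... | _        | yes refl = hasPair-full (B' ∪ₑ ⁅ a ⁆ₑ) λ b →
        trans (χ-∪⁅y⁆-x B' (k , b) a (j≢i ∘ ,-injectiveˡ)) (χ-∪skew∖skew-i T j i j≢i b)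
      ... | yes refl | no _     = hasPair-absent (B' ∪ₑ ⁅ a ⁆ₑ) (not s)
        (trans (χ-∪⁅y⁆-x B' (star a) a (star≢ a)) (χ-∪skew∖skew-j T j i (not s)))
      ... | no k≢i   | no k≢j   = trans (hasPair-cong (B' ∪ₑ ⁅ a ⁆ₑ) T λ b →
          trans (χ-∪⁅y⁆-x B' (k , b) a (k≢i ∘ ,-injectiveˡ)) (χ-∪skew∖skew-k T j i k≢j k≢i b))
        (T-noPair k)

      B'∖B⊆pair-j : ∀ k b → (k , b) ∈ₑ B' → (k , b) ∉ₑ B → k ≡ j
      B'∖B⊆pair-j k b k∈B' k∉B with k ≟ i | k ≟ j
      ... | _        | yes k≡j = k≡j
      ... | yes refl | no _    = contradiction k∈B' (χ⇒∉ₑ (k , b) (χ-∪skew∖skew-j T j i b))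
      ... | no k≢i   | no k≢j  = contradiction (χ⇒∈ₑ (k , b) (begin
        χ B (k , b)  ≡⟨ χ-∪skew∖skew-k T i j k≢i k≢j b ⟩
        χ T (k , b)  ≡⟨ χ-∪skew∖skew-k T j i k≢j k≢i b ⟨
        χ B' (k , b) ≡⟨ ∈ₑ⇒χ (k , b) k∈B' ⟩
        true         ∎)) k∉B
        where open ≡-Reasoning

    exchange-into-missingPair : IsBasis B → ∃ λ t → IsBasis ((B ∖ₑ ⁅ a ⁆ₑ) ∪ₑ ⁅ (j , t) ⁆ₑ)
    exchange-into-missingPair isB
      with (k , t) , f∈B' , f∉B , isB* , _ ←
             Exch B B' a isB (Equivalence.to (B2 T i j T-transversal i≢j) isB) a∈B a∉B'
                  (noPair⇒#skew≡0 (B ∖ₑ ⁅ a ⁆ₑ) B∖a-noPair)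
                  (uniquePair⇒#skew≡1 (B' ∪ₑ ⁅ a ⁆ₑ) j B'∪a-uniquePair)
      with refl ← B'∖B⊆pair-j k t f∈B' f∉B
      = t , isB*

    exchanged-noSkew : ∀ t → #skew ((B ∖ₑ ⁅ a ⁆ₑ) ∪ₑ ⁅ (j , t) ⁆ₑ) ≡ 0
    exchanged-noSkew t = noPair⇒#skew≡0 B* B*-noPair
      where
      B* : ESet n
      B* = (B ∖ₑ ⁅ a ⁆ₑ) ∪ₑ ⁅ (j , t) ⁆ₑ
      B*-noPair : ∀ k → hasPair B* k ≡ false
      B*-noPair k with k ≟ j
      ... | yes refl = hasPair-absent B* (not t) (begin
        χ B* (j , not t)            ≡⟨ χ-∪⁅y⁆-x (B ∖ₑ ⁅ a ⁆ₑ) (j , not t) (j , t) (star≢ (j , t)) ⟩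
        χ (B ∖ₑ ⁅ a ⁆ₑ) (j , not t) ≡⟨ χ-∖⁅y⁆-x B (j , not t) a (j≢i ∘ ,-injectiveˡ) ⟩
        χ B (j , not t)             ≡⟨ χ-∪skew∖skew-j T i j (not t) ⟩
        false                       ∎)
        where open ≡-Reasoning
      ... | no k≢j = trans (hasPair-cong B* (B ∖ₑ ⁅ a ⁆ₑ) λ b → χ-∪⁅y⁆-x (B ∖ₑ ⁅ a ⁆ₑ) (k , b) (j , t) (k≢j ∘ ,-injectiveˡ))
                           (B∖a-noPair k)

  noSkew-independent⇒⊆transversalBasis : ∀ (X : ESet n) → #skew X ≡ 0 → Independent X →
    ∃ λ B → IsBasis B × IsTransversal B × X ⊆ₑ B
  noSkew-independent⇒⊆transversalBasis X #skew≡0 (B , isB , X⊆B) with basis-type B isB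
  ... | inj₁ transversal = B , isB , transversal , X⊆B
  ... | inj₂ almost
    with i , j , T , T-transversal , i≢j , refl ← almostTransversal-decomposition B almost
    with s , is∉X ← noPair⇒absent X (#skew≡0⇒noPair X #skew≡0 i)
    with t , isB* ← exchange-into-missingPair T T-transversal i≢j s isB
    = _ , isB* , basis∧#skew≡0⇒transversal isB* (exchanged-noSkew T T-transversal i≢j s t)
        , ⊆-∪ ⁅ (j , t) ⁆ₑ (⊆-∖⁅x⁆ X⊆B (χ⇒∉ₑ (i , s) is∉X))

  dependent∧C∖⁅e⁆⊆B⇒C∖B≡⁅e⁆ : ∀ {C B : ESet n} {e} → ¬ Independent C → e ∈ₑ C → IsBasis B →
    (C ∖ₑ ⁅ e ⁆ₑ) ⊆ₑ B → C ∖ₑ B ≡ ⁅ e ⁆ₑ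
  dependent∧C∖⁅e⁆⊆B⇒C∖B≡⁅e⁆ {C} {B} {e} C-dependent e∈C isB C∖e⊆B = χ-injective (C ∖ₑ B) ⁅ e ⁆ₑ C∖B≗⁅e⁆
    where
    C⊆B-off-e : ∀ x → x ≢ e → x ∈ₑ C → x ∈ₑ B
    C⊆B-off-e x x≢e x∈C = C∖e⊆B x (χ⇒∈ₑ x (trans (χ-∖⁅y⁆-x C x e x≢e) (∈ₑ⇒χ x x∈C)))

    e∉B : e ∉ₑ B
    e∉B e∈B = C-dependent (B , isB , C⊆B)
      where
      C⊆B : C ⊆ₑ B
      C⊆B x x∈C with x ≟ₑ e
      ... | yes refl = e∈B
      ... | no x≢e   = C⊆B-off-e x x≢e x∈C

    C∖B≗⁅e⁆ : ∀ x → χ (C ∖ₑ B) x ≡ χ ⁅ e ⁆ₑ x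
    C∖B≗⁅e⁆ x rewrite χ-∖ C B x with x ≟ₑ e
    ... | yes refl rewrite ∈ₑ⇒χ x e∈C | ∉ₑ⇒χ x e∉B = sym (χ-⁅x⁆-x x)
    ... | no x≢e with χ C x in x∈C
    ...   | false = sym (χ-⁅y⁆-x x≢e)
    ...   | true rewrite ∈ₑ⇒χ x (C⊆B-off-e x x≢e (χ⇒∈ₑ x x∈C)) = sym (χ-⁅y⁆-x x≢e)

lemma3p6 : ∀ {n} (M : AntisymmetricMatroid n) (C : ESet n) (e : Elem n) →
    AntisymmetricMatroid.IsCircuit M C → e ∈ₑ C → #skew (C ∖ₑ ⁅ e ⁆ₑ) ≡ 0 →
    ∃ λ B → AntisymmetricMatroid.IsBasis M B × IsTransversal B ×
      (C ∖ₑ B) ≐ ⁅ e ⁆ₑ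
lemma3p6 M C e ((_ , C-dependent) , C-minimal) e∈C #skew≡0 =
  let C∖e-independent = C-minimal (C ∖ₑ ⁅ e ⁆ₑ) (∖⁅x⁆⊂ e∈C) (subst (_≤ 1) (sym #skew≡0) z≤n)
      B , isB , B-transversal , C∖e⊆B = noSkew-independent⇒⊆transversalBasis M _ #skew≡0 C∖e-independent
  in  B , isB , B-transversal , ≡⇒≐ (dependent∧C∖⁅e⁆⊆B⇒C∖B≡⁅e⁆ M C-dependent e∈C isB C∖e⊆B)
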